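{- Let $t,u$ be $\lambda$-terms. (1) If $t\to_{\sigma}u$ then $\mathrm{mnf}(t)\equiv\mathrm{mnf}(u)$. (2) If $t\to_{\beta_v}u$ (in the shuffling calculus) then $\mathrm{mnf}(t)\to_{\mathtt e}\to_{\mathtt m}^*\mathrm{mnf}(u)$.
   Context: $\lambda$-terms: $t,u,s::= v\mid tu$, values $v::= x\mid \lambda x.t$, up to $\alpha$; $t\{x\leftarrow u\}$ capture-avoiding substitution. Shuffling calculus: balanced contexts $B::=\langle\cdot\rangle\mid tB\mid Bt\mid (\lambda x.B)t$. $\to_{\sigma}$ is the closure under balanced contexts of $((\lambda x.t)u)s\mapsto(\lambda x.ts)u$ ($x\notin\mathrm{fv}(s)$) and $v((\lambda x.s)u)\mapsto(\lambda x.vs)u$ ($v$ a value, $x\notin\mathrm{fv}(v)$); $\to_{\beta_v}$ is the closure under balanced contexts of $(\lambda x.t)v\mapsto t\{x\leftarrow v\}$ ($v$ a value). Value substitution calculus: vsub-terms $t,u::= v\mid tu\mid t[x\leftarrow u]$, vsub-values $v::=x\mid\lambda x.t$; $t[x\leftarrow u]$ binds $x$ in $t$; every $\lambda$-term is a vsub-term. Evaluation contexts $E::=\langle\cdot\rangle\mid tE\mid Et\mid E[x\leftarrow u]\mid t[x\leftarrow E]$; substitution contexts $L::=\langle\cdot\rangle\mid L[x\leftarrow u]$. $\to_{\mathtt m}$: closure under evaluation contexts of $L\langle\lambda x.t\rangle u\mapsto L\langle t[x\leftarrow u]\rangle$; $\to_{\mathtt e}$: closure of $t[x\leftarrow L\langle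 v\rangle]\mapsto L\langle t\{x\leftarrow v\}\rangle$ ($v$ vsub-value; bound variables of $L$ not free in $u$, resp. $t$). $\to_{\mathtt m}$ is terminating and confluent, so each vsub-term $t$ has a unique $\mathtt m$-normal form $\mathrm{mnf}(t)$. Structural equivalence $\equiv$: least equivalence on vsub-terms closed under evaluation contexts containing $t[y\leftarrow s][x\leftarrow u]\equiv t[x\leftarrow u][y\leftarrow s]$ ($y\notin\mathrm{fv}(u)$, $x\notin\mathrm{fv}(s)$); $t\,(s[x\leftarrow u])\equiv (ts)[x\leftarrow u]$ ($x\notin\mathrm{fv}(t)$); $t[x\leftarrow u]\,s\equiv (ts)[x\leftarrow u]$ ($x\notin\mathrm{fv}(s)$); $t[x\leftarrow u[y\leftarrow s]]\equiv t[x\leftarrow u][y\leftarrow s]$ ($y\notin\mathrm{fv}(t)$). -}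

module Defs where

-- Terms are represented with well-scoped de Bruijn indices, so that
-- alpha-equivalence is syntactic equality and "x not free in s" side
-- conditions become weakenings.

open import Data.Nat using (ℕ; zero; suc)
open import Data.Fin using (Fin; zero; suc)
open import Data.Product using (∃; _×_)
open import Relation.Nullary using (¬_)
open import Relation.Binary.Construct.Closure.ReflexiveTransitive using (Star)

data Λ (n : ℕ) : Set where
  var : Fin n → Λ n
  lam : Λ (suc n) → Λ n
  app : Λ n → Λ n → Λ n

data ΛValue {n : ℕ} : Λ n → Set where
  var : (x : Fin n) → ΛValue (var x)
  lam : (t : Λ (suc n)) → ΛValue (lam t)

liftRen : ∀ {n m} → (Fin n → Fin m) → Fin (suc n) → Fin (suc m)
liftRen ρ zero    = zero
liftRen ρ (suc i) = suc (ρ i)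

renΛ : ∀ {n m} → (Fin n → Fin m) → Λ n → Λ m
renΛ ρ (var x)   = var (ρ x)
renΛ ρ (lam t)   = lam (renΛ (liftRen ρ) t)
renΛ ρ (app t u) = app (renΛ ρ t) (renΛ ρ u)

wkΛ : ∀ {n} → Λ n → Λ (suc n)
wkΛ = renΛ suc

liftSubΛ : ∀ {n m} → (Fin n → Λ m) → Fin (suc n) → Λ (suc m)
liftSubΛ σ zero    = var zero
liftSubΛ σ (suc i) = wkΛ (σ i)

subΛ : ∀ {n m} → (Fin n → Λ m) → Λ n → Λ m
subΛ σ (var x)   = σ x
subΛ σ (lam t)   = lam (subΛ (liftSubΛ σ) t)
subΛ σ (app t u) = app (subΛ σ t) (subΛ σ u)

single : ∀ {A : ℕ → Set} {n} → (Fin n → A n) → A n → Fin (suc n) → A n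
single η u zero    = u
single η u (suc i) = η i

_⟦0≔_⟧Λ : ∀ {n} → Λ (suc n) → Λ n → Λ n
t ⟦0≔ u ⟧Λ = subΛ (single {Λ} var u) t

-- σ-steps, closed under balanced contexts B ::= ⟨⟩ | tB | Bt | (λx.B)t
data _→σ_ {n : ℕ} : Λ n → Λ n → Set where
  σ₁ : (t : Λ (suc n)) (u s : Λ n) →
       app (app (lam t) u) s →σ app (lam (app t (wkΛ s))) u
  σ₃ : (v : Λ n) → ΛValue v → (s : Λ (suc n)) (u : Λ n) →
       app v (app (lam s) u) →σ app (lam (app (wkΛ v) s)) u
  appR : ∀ {t u u'} → u →σ u' → app t u →σ app t u'
  appL : ∀ {t t' u} → t →σ t' → app t u →σ app t' u
  redex : ∀ {t t' : Λ (suc n)} {u} → t →σ t' → app (lam t) u →σ app (lam t') u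

data _→βv_ {n : ℕ} : Λ n → Λ n → Set where
  βv : (t : Λ (suc n)) (v : Λ n) → ΛValue v → app (lam t) v →βv (t ⟦0≔ v ⟧Λ)
  appR : ∀ {t u u'} → u →βv u' → app t u →βv app t u'
  appL : ∀ {t t' u} → t →βv t' → app t u →βv app t' u
  redex : ∀ {t t' : Λ (suc n)} {u} → t →βv t' → app (lam t) u →βv app (lam t') u

-- esub t u  represents  t[x←u]  (x = de Bruijn 0, bound in t)
data Tm (n : ℕ) : Set where
  var  : Fin n → Tm n
  lam  : Tm (suc n) → Tm n
  app  : Tm n → Tm n → Tm n
  esub : Tm (suc n) → Tm n → Tm n

data Value {n : ℕ} : Tm n → Set where
  var : (x : Fin n) → Value (var x)
  lam : (t : Tm (suc n)) → Value (lam t)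

⌜_⌝ : ∀ {n} → Λ n → Tm n
⌜ var x ⌝   = var x
⌜ lam t ⌝   = lam ⌜ t ⌝
⌜ app t u ⌝ = app ⌜ t ⌝ ⌜ u ⌝

ren : ∀ {n m} → (Fin n → Fin m) → Tm n → Tm m
ren ρ (var x)    = var (ρ x)
ren ρ (lam t)    = lam (ren (liftRen ρ) t)
ren ρ (app t u)  = app (ren ρ t) (ren ρ u)
ren ρ (esub t u) = esub (ren (liftRen ρ) t) (ren ρ u)

wk : ∀ {n} → Tm n → Tm (suc n)
wk = ren suc

liftSub : ∀ {n m} → (Fin n → Tm m) → Fin (suc n) → Tm (suc m)
liftSub σ zero    = var zero
liftSub σ (suc i) = wk (σ i)

sub : ∀ {n m} → (Fin n → Tm m) → Tm n → Tm m
sub σ (var x)    = σ x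
sub σ (lam t)    = lam (sub (liftSub σ) t)
sub σ (app t u)  = app (sub σ t) (sub σ u)
sub σ (esub t u) = esub (sub (liftSub σ) t) (sub σ u)

_⟦0≔_⟧ : ∀ {n} → Tm (suc n) → Tm n → Tm n
t ⟦0≔ u ⟧ = sub (single {Tm} var u) t

swap01 : ∀ {n} → Fin (suc (suc n)) → Fin (suc (suc n))
swap01 zero          = suc zero
swap01 (suc zero)    = zero
swap01 (suc (suc i)) = suc (suc i)

-- substitution contexts L ::= ⟨⟩ | L[x←u];  SCtx n m : outer scope n, hole scope m
data SCtx : ℕ → ℕ → Set where
  hole : ∀ {n} → SCtx n n
  _[≔_] : ∀ {n m} → SCtx (suc n) m → Tm n → SCtx n m

_⟨_⟩ : ∀ {n m} → SCtx n m → Tm m → Tm n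
hole ⟨ t ⟩       = t
(L [≔ u ]) ⟨ t ⟩ = esub (L ⟨ t ⟩) u

wkL : ∀ {n m} → SCtx n m → Fin n → Fin m
wkL hole       i = i
wkL (L [≔ u ]) i = wkL L (suc i)

data EClos (R : ∀ {n} → Tm n → Tm n → Set) {n : ℕ} : Tm n → Tm n → Set where
  root  : ∀ {t u} → R t u → EClos R t u
  appR  : ∀ {t u u'} → EClos R u u' → EClos R (app t u) (app t u')
  appL  : ∀ {t t' u} → EClos R t t' → EClos R (app t u) (app t' u)
  esubL : ∀ {t t' : Tm (suc n)} {u} → EClos R t t' → EClos R (esub t u) (esub t' u)
  esubR : ∀ {t : Tm (suc n)} {u u'} → EClos R u u' → EClos R (esub t u) (esub t u')

data mRoot {n : ℕ} : Tm n → Tm n → Set where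
  dB : ∀ {m} (L : SCtx n m) (t : Tm (suc m)) (u : Tm n) →
       mRoot (app (L ⟨ lam t ⟩) u) (L ⟨ esub t (ren (wkL L) u) ⟩)

data eRoot {n : ℕ} : Tm n → Tm n → Set where
  sv : ∀ {m} (t : Tm (suc n)) (L : SCtx n m) (v : Tm m) → Value v →
       eRoot (esub t (L ⟨ v ⟩)) (L ⟨ ren (liftRen (wkL L)) t ⟦0≔ v ⟧ ⟩)

_→m_ : ∀ {n} → Tm n → Tm n → Set
_→m_ = EClos mRoot

_→e_ : ∀ {n} → Tm n → Tm n → Set
_→e_ = EClos eRoot

_→m*_ : ∀ {n} → Tm n → Tm n → Set
_→m*_ = Star _→m_

mNormal : ∀ {n} → Tm n → Set
mNormal t = ¬ ∃ (λ t' → t →m t')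

IsMnf : ∀ {n} → Tm n → Tm n → Set
IsMnf t s = t →m* s × mNormal s

data _≡s_ {n : ℕ} : Tm n → Tm n → Set where
  ≡refl  : ∀ {t} → t ≡s t
  ≡sym   : ∀ {t u} → t ≡s u → u ≡s t
  ≡trans : ∀ {t u s} → t ≡s u → u ≡s s → t ≡s s
  -- t[y←s][x←u] ≡ t[x←u][y←s]   (y ∉ fv u, x ∉ fv s)
  ≡com   : (t : Tm (suc (suc n))) (s u : Tm n) →
           esub (esub t (wk s)) u ≡s esub (esub (ren swap01 t) (wk u)) s
  -- t (s[x←u]) ≡ (t s)[x←u]   (x ∉ fv t)
  ≡appR  : (t : Tm n) (s : Tm (suc n)) (u : Tm n) →
           app t (esub s u) ≡s esub (app (wk t) s) u
  -- t[x←u] s ≡ (t s)[x←u]   (x ∉ fv s)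
  ≡appL  : (t : Tm (suc n)) (u s : Tm n) →
           app (esub t u) s ≡s esub (app t (wk s)) u
  -- t[x←u[y←s]] ≡ t[x←u][y←s]   (y ∉ fv t)
  ≡assoc : (t : Tm (suc n)) (u : Tm (suc n)) (s : Tm n) →
           esub t (esub u s) ≡s esub (esub (ren (liftRen suc) t) u) s
  ctxAppR  : ∀ {t u u'} → u ≡s u' → app t u ≡s app t u'
  ctxAppL  : ∀ {t t' u} → t ≡s t' → app t u ≡s app t' u
  ctxEsubL : ∀ {t t' : Tm (suc n)} {u} → t ≡s t' → esub t u ≡s esub t' u
  ctxEsubR : ∀ {t : Tm (suc n)} {u u'} → u ≡s u' → esub t u ≡s esub t u'

-- The m-normal form is computed by a structural function mnf that is invariant under
-- m-steps and reached by them, so any m-normal form of t is ⌊ mnf t ⌋.  A σ-step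
-- changes mnf ⌜ t ⌝ only up to the structural equivalence, applied to answers
-- L⟨λx.s⟩ of matching shape.  A βv-step is simulated as ⌜ t ⌝ →m* x →e y ←m* ⌜ u ⌝,
-- the redex being first turned into an explicit substitution; an e-step from x
-- can then be replayed from ⌊ mnf x ⌋, reaching a term with the same mnf as y.

module Submission where

open import Defs
open import Data.Nat using (ℕ; zero; suc)
open import Data.Fin using (Fin; zero; suc)
open import Data.Product using (∃; ∃₂; _×_; _,_; proj₁; proj₂)
open import Data.Empty using (⊥-elim)
open import Function using (_∘_; id)
open import Relation.Binary.PropositionalEquality
open import Relation.Binary.Construct.Closure.ReflexiveTransitive using (ε; _◅_; _◅◅_; gmap)

private
  variable
    n m k : ℕ

liftRen-cong : {ρ ρ' : Fin n → Fin m} → ρ ≗ ρ' → liftRen ρ ≗ liftRen ρ'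
liftRen-cong h zero    = refl
liftRen-cong h (suc i) = cong suc (h i)

ren-cong : {ρ ρ' : Fin n → Fin m} → ρ ≗ ρ' → ren ρ ≗ ren ρ'
ren-cong h (var x)    = cong var (h x)
ren-cong h (lam t)    = cong lam (ren-cong (liftRen-cong h) t)
ren-cong h (app t u)  = cong₂ app (ren-cong h t) (ren-cong h u)
ren-cong h (esub t u) = cong₂ esub (ren-cong (liftRen-cong h) t) (ren-cong h u)

liftRen-∘ : (ρ : Fin m → Fin k) (ρ' : Fin n → Fin m) → liftRen ρ ∘ liftRen ρ' ≗ liftRen (ρ ∘ ρ')
liftRen-∘ ρ ρ' zero    = refl
liftRen-∘ ρ ρ' (suc i) = refl

ren-∘ : (ρ : Fin m → Fin k) (ρ' : Fin n → Fin m) → ren ρ ∘ ren ρ' ≗ ren (ρ ∘ ρ')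
ren-∘ ρ ρ' (var x)    = refl
ren-∘ ρ ρ' (lam t)    = cong lam (trans (ren-∘ _ _ t) (ren-cong (liftRen-∘ ρ ρ') t))
ren-∘ ρ ρ' (app t u)  = cong₂ app (ren-∘ ρ ρ' t) (ren-∘ ρ ρ' u)
ren-∘ ρ ρ' (esub t u) = cong₂ esub (trans (ren-∘ _ _ t) (ren-cong (liftRen-∘ ρ ρ') t)) (ren-∘ ρ ρ' u)

liftRen-id : {ρ : Fin n → Fin n} → ρ ≗ id → liftRen ρ ≗ id
liftRen-id h zero    = refl
liftRen-id h (suc i) = cong suc (h i)

ren-id : {ρ : Fin n → Fin n} → ρ ≗ id → ren ρ ≗ id
ren-id h (var x)    = cong var (h x)
ren-id h (lam t)    = cong lam (ren-id (liftRen-id h) t)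
ren-id h (app t u)  = cong₂ app (ren-id h t) (ren-id h u)
ren-id h (esub t u) = cong₂ esub (ren-id (liftRen-id h) t) (ren-id h u)

ren-commute : {m' : ℕ} (ρ₁ : Fin m → Fin k) (ρ₂ : Fin n → Fin m) (ρ₃ : Fin m' → Fin k) (ρ₄ : Fin n → Fin m') →
              ρ₁ ∘ ρ₂ ≗ ρ₃ ∘ ρ₄ → ren ρ₁ ∘ ren ρ₂ ≗ ren ρ₃ ∘ ren ρ₄
ren-commute ρ₁ ρ₂ ρ₃ ρ₄ h t = trans (ren-∘ ρ₁ ρ₂ t) (trans (ren-cong h t) (sym (ren-∘ ρ₃ ρ₄ t)))

ren-wk : (ρ : Fin n → Fin m) (t : Tm n) → ren (liftRen ρ) (wk t) ≡ wk (ren ρ t)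
ren-wk ρ = ren-commute _ _ _ _ (λ _ → refl)

ren-liftRen-wk : (ρ : Fin n → Fin m) (t : Tm (suc n)) →
                 ren (liftRen (liftRen ρ)) (ren (liftRen suc) t) ≡ ren (liftRen suc) (ren (liftRen ρ) t)
ren-liftRen-wk ρ = ren-commute _ _ _ _ λ { zero → refl ; (suc i) → refl }

liftSub-cong : {σ σ' : Fin n → Tm m} → σ ≗ σ' → liftSub σ ≗ liftSub σ'
liftSub-cong h zero    = refl
liftSub-cong h (suc i) = cong wk (h i)

sub-cong : {σ σ' : Fin n → Tm m} → σ ≗ σ' → sub σ ≗ sub σ'
sub-cong h (var x)    = h x
sub-cong h (lam t)    = cong lam (sub-cong (liftSub-cong h) t)
sub-cong h (app t u)  = cong₂ app (sub-cong h t) (sub-cong h u)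
sub-cong h (esub t u) = cong₂ esub (sub-cong (liftSub-cong h) t) (sub-cong h u)

liftSub-liftRen : (σ : Fin m → Tm k) (ρ : Fin n → Fin m) → liftSub σ ∘ liftRen ρ ≗ liftSub (σ ∘ ρ)
liftSub-liftRen σ ρ zero    = refl
liftSub-liftRen σ ρ (suc i) = refl

sub-ren : (σ : Fin m → Tm k) (ρ : Fin n → Fin m) → sub σ ∘ ren ρ ≗ sub (σ ∘ ρ)
sub-ren σ ρ (var x)    = refl
sub-ren σ ρ (lam t)    = cong lam (trans (sub-ren _ _ t) (sub-cong (liftSub-liftRen σ ρ) t))
sub-ren σ ρ (app t u)  = cong₂ app (sub-ren σ ρ t) (sub-ren σ ρ u)
sub-ren σ ρ (esub t u) = cong₂ esub (trans (sub-ren _ _ t) (sub-cong (liftSub-liftRen σ ρ) t)) (sub-ren σ ρ u)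

liftRen-liftSub : (ρ : Fin m → Fin k) (σ : Fin n → Tm m) → ren (liftRen ρ) ∘ liftSub σ ≗ liftSub (ren ρ ∘ σ)
liftRen-liftSub ρ σ zero    = refl
liftRen-liftSub ρ σ (suc i) = ren-wk ρ (σ i)

ren-sub : (ρ : Fin m → Fin k) (σ : Fin n → Tm m) → ren ρ ∘ sub σ ≗ sub (ren ρ ∘ σ)
ren-sub ρ σ (var x)    = refl
ren-sub ρ σ (lam t)    = cong lam (trans (ren-sub _ _ t) (sub-cong (liftRen-liftSub ρ σ) t))
ren-sub ρ σ (app t u)  = cong₂ app (ren-sub ρ σ t) (ren-sub ρ σ u)
ren-sub ρ σ (esub t u) = cong₂ esub (trans (ren-sub _ _ t) (sub-cong (liftRen-liftSub ρ σ) t)) (ren-sub ρ σ u)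

liftSub-id : {σ : Fin n → Tm n} → σ ≗ var → liftSub σ ≗ var
liftSub-id h zero    = refl
liftSub-id h (suc i) = cong wk (h i)

sub-id : {σ : Fin n → Tm n} → σ ≗ var → sub σ ≗ id
sub-id h (var x)    = h x
sub-id h (lam t)    = cong lam (sub-id (liftSub-id h) t)
sub-id h (app t u)  = cong₂ app (sub-id h t) (sub-id h u)
sub-id h (esub t u) = cong₂ esub (sub-id (liftSub-id h) t) (sub-id h u)

ren≗sub : (ρ : Fin n → Fin m) → ren ρ ≗ sub (var ∘ ρ)
ren≗sub ρ t = trans (sym (sub-id (λ _ → refl) (ren ρ t))) (sub-ren var ρ t)

wk-⟦0≔⟧ : (t : Tm n) (v : Tm n) → wk t ⟦0≔ v ⟧ ≡ t
wk-⟦0≔⟧ t v = trans (sub-ren _ suc t) (sub-id (λ _ → refl) t)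

sub-wk : (σ : Fin n → Tm m) (t : Tm n) → sub (liftSub σ) (wk t) ≡ wk (sub σ t)
sub-wk σ t = trans (sub-ren _ suc t) (sym (ren-sub suc σ t))

ren-⟦0≔⟧ : (ρ : Fin n → Fin m) (t : Tm (suc n)) (v : Tm n) →
           ren ρ (t ⟦0≔ v ⟧) ≡ ren (liftRen ρ) t ⟦0≔ ren ρ v ⟧
ren-⟦0≔⟧ ρ t v = trans (ren-sub ρ _ t) (trans (sub-cong ren∘single t) (sym (sub-ren _ _ t)))
  where
  ren∘single : ren ρ ∘ single {Tm} var v ≗ single {Tm} var (ren ρ v) ∘ liftRen ρ
  ren∘single zero    = refl
  ren∘single (suc i) = refl

-- Root steps, one explicit substitution of the context L at a time

infix 4 _↦m_ _↦e_

data _↦m_ {n : ℕ} : Tm n → Tm n → Set where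
  dB      : ∀ r u → app (lam r) u ↦m esub r u
  dB-esub : ∀ {t t'} w u → app t (wk u) ↦m t' → app (esub t w) u ↦m esub t' w

data _↦e_ {n : ℕ} : Tm n → Tm n → Set where
  sv      : ∀ t {v} → Value v → esub t v ↦e t ⟦0≔ v ⟧
  sv-esub : ∀ {t V z} w → esub (ren (liftRen suc) t) V ↦e z → esub t (esub V w) ↦e esub z w

mRoot⇒↦m : {a b : Tm n} → mRoot a b → a ↦m b
mRoot⇒↦m (dB L r u) = dB-under L r u
  where
  dB-under : ∀ {n m} (L : SCtx n m) r u → app (L ⟨ lam r ⟩) u ↦m L ⟨ esub r (ren (wkL L) u) ⟩
  dB-under hole       r u = subst (λ z → app (lam r) u ↦m esub r z) (sym (ren-id (λ _ → refl) u)) (dB r u)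
  dB-under (L [≔ w ]) r u = subst (λ z → app (esub (L ⟨ lam r ⟩) w) u ↦m esub (L ⟨ esub r z ⟩) w)
                                  (ren-∘ (wkL L) suc u) (dB-esub w u (dB-under L r (wk u)))

↦m⇒mRoot : {a b : Tm n} → a ↦m b → mRoot a b
↦m⇒mRoot (dB r u) =
  subst (λ z → mRoot (app (lam r) u) (esub r z)) (ren-id (λ _ → refl) u) (dB hole r u)
↦m⇒mRoot (dB-esub w u h) = under-esub (↦m⇒mRoot h)
  where
  under-esub : ∀ {t t'} → mRoot (app t (wk u)) t' → mRoot (app (esub t w) u) (esub t' w)
  under-esub (dB L r _) = subst (λ z → mRoot (app (esub (L ⟨ lam r ⟩) w) u) (esub (L ⟨ esub r z ⟩) w))
                                (sym (ren-∘ (wkL L) suc u)) (dB (L [≔ w ]) r u)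

eRoot⇒↦e : {a b : Tm n} → eRoot a b → a ↦e b
eRoot⇒↦e (sv {m'} t L v val) = sv-under t L
  where
  sv-under : ∀ {n} t (L : SCtx n m') → esub t (L ⟨ v ⟩) ↦e L ⟨ ren (liftRen (wkL L)) t ⟦0≔ v ⟧ ⟩
  sv-under t hole       = subst (λ z → esub t v ↦e z ⟦0≔ v ⟧) (sym (ren-id (liftRen-id (λ _ → refl)) t))
                                (sv t val)
  sv-under t (L [≔ w ]) = subst (λ z → esub t (esub (L ⟨ v ⟩) w) ↦e esub (L ⟨ z ⟦0≔ v ⟧ ⟩) w)
                                (trans (ren-∘ _ _ t) (ren-cong (liftRen-∘ (wkL L) suc) t))
                                (sv-esub w (sv-under (ren (liftRen suc) t) L))

↦e⇒eRoot : {a b : Tm n} → a ↦e b → eRoot a b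
↦e⇒eRoot (sv t {v} val)   = subst (λ z → eRoot (esub t v) (z ⟦0≔ v ⟧)) (ren-id (liftRen-id (λ _ → refl)) t)
                                  (sv t hole v val)
↦e⇒eRoot (sv-esub {t} w h) = under-esub (↦e⇒eRoot h)
  where
  under-esub : ∀ {V z} → eRoot (esub (ren (liftRen suc) t) V) z → eRoot (esub t (esub V w)) (esub z w)
  under-esub (sv _ L v val) = subst (λ z → eRoot (esub t (esub (L ⟨ v ⟩) w)) (esub (L ⟨ z ⟦0≔ v ⟧ ⟩) w))
                                    (sym (trans (ren-∘ _ _ t) (ren-cong (liftRen-∘ (wkL L) suc) t)))
                                    (sv t (L [≔ w ]) v val)

↦m⇒→m : {a b : Tm n} → a ↦m b → a →m b
↦m⇒→m = root ∘ ↦m⇒mRoot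

↦e⇒→e : {a b : Tm n} → a ↦e b → a →e b
↦e⇒→e = root ∘ ↦e⇒eRoot

appL* : ∀ {t t' : Tm n} u → t →m* t' → app t u →m* app t' u
appL* u = gmap (λ z → app z u) appL

appR* : ∀ {u u' : Tm n} t → u →m* u' → app t u →m* app t u'
appR* t = gmap (app t) appR

esubL* : ∀ {t t' : Tm (suc n)} u → t →m* t' → esub t u →m* esub t' u
esubL* u = gmap (λ z → esub z u) esubL

esubR* : ∀ {u u' : Tm n} t → u →m* u' → esub t u →m* esub t u'
esubR* t = gmap (esub t) esubR

↦m-sub : (σ : Fin n → Tm m) {a b : Tm n} → a ↦m b → sub σ a ↦m sub σ b
↦m-sub σ (dB r u)                 = dB _ _
↦m-sub σ (dB-esub {t} {t'} w u h) =
  dB-esub (sub σ w) (sub σ u)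
          (subst (λ z → app (sub (liftSub σ) t) z ↦m sub (liftSub σ) t') (sub-wk σ u) (↦m-sub (liftSub σ) h))

→m-sub : (σ : Fin n → Tm m) {a b : Tm n} → a →m b → sub σ a →m sub σ b
→m-sub σ (root h)  = ↦m⇒→m (↦m-sub σ (mRoot⇒↦m h))
→m-sub σ (appR h)  = appR (→m-sub σ h)
→m-sub σ (appL h)  = appL (→m-sub σ h)
→m-sub σ (esubL h) = esubL (→m-sub (liftSub σ) h)
→m-sub σ (esubR h) = esubR (→m-sub σ h)

→m*-sub : (σ : Fin n → Tm m) {a b : Tm n} → a →m* b → sub σ a →m* sub σ b
→m*-sub σ = gmap (sub σ) (→m-sub σ)

→m*-ren : (ρ : Fin n → Fin m) {a b : Tm n} → a →m* b → ren ρ a →m* ren ρ b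
→m*-ren ρ {a} {b} h = subst₂ _→m*_ (sym (ren≗sub ρ a)) (sym (ren≗sub ρ b)) (→m*-sub (var ∘ ρ) h)

Value-ren : (ρ : Fin n → Fin m) {v : Tm n} → Value v → Value (ren ρ v)
Value-ren ρ (var x) = var _
Value-ren ρ (lam t) = lam _

↦e-ren : (ρ : Fin n → Fin m) {a b : Tm n} → a ↦e b → ren ρ a ↦e ren ρ b
↦e-ren ρ (sv t {v} val) =
  subst (ren ρ (esub t v) ↦e_) (sym (ren-⟦0≔⟧ ρ t v)) (sv _ (Value-ren ρ val))
↦e-ren ρ (sv-esub {t} {V} {z} w h) =
  sv-esub (ren ρ w) (subst (λ q → esub q (ren (liftRen ρ) V) ↦e ren (liftRen ρ) z)
                           (ren-liftRen-wk ρ t) (↦e-ren (liftRen ρ) h))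

→e-ren : (ρ : Fin n → Fin m) {a b : Tm n} → a →e b → ren ρ a →e ren ρ b
→e-ren ρ (root h)  = ↦e⇒→e (↦e-ren ρ (eRoot⇒↦e h))
→e-ren ρ (appR h)  = appR (→e-ren ρ h)
→e-ren ρ (appL h)  = appL (→e-ren ρ h)
→e-ren ρ (esubL h) = esubL (→e-ren (liftRen ρ) h)
→e-ren ρ (esubR h) = esubR (→e-ren ρ h)

data IsAnswer {n : ℕ} : Tm n → Set where
  ans-lam  : ∀ r → IsAnswer (lam r)
  ans-esub : ∀ {t} w → IsAnswer t → IsAnswer (esub t w)

IsAnswer-ren : (ρ : Fin n → Fin m) {t : Tm n} → IsAnswer t → IsAnswer (ren ρ t)
IsAnswer-ren ρ (ans-lam r)    = ans-lam _
IsAnswer-ren ρ (ans-esub w h) = ans-esub _ (IsAnswer-ren (liftRen ρ) h)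

IsAnswer-sub : (σ : Fin n → Tm m) {t : Tm n} → IsAnswer t → IsAnswer (sub σ t)
IsAnswer-sub σ (ans-lam r)    = ans-lam _
IsAnswer-sub σ (ans-esub w h) = ans-esub _ (IsAnswer-sub (liftSub σ) h)

↦m-IsAnswer : {t u t' : Tm n} → app t u ↦m t' → IsAnswer t
↦m-IsAnswer (dB r u)        = ans-lam r
↦m-IsAnswer (dB-esub w u h) = ans-esub w (↦m-IsAnswer h)

↦e-IsAnswer : {t : Tm (suc n)} {w z : Tm n} → esub t w ↦e z → IsAnswer t → IsAnswer z
↦e-IsAnswer (sv t val)     h = IsAnswer-sub _ h
↦e-IsAnswer (sv-esub w st) h = ans-esub w (↦e-IsAnswer st (IsAnswer-ren _ h))

→e-IsAnswer : {t z : Tm n} → t →e z → IsAnswer t → IsAnswer z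
→e-IsAnswer (root st)  (ans-esub w h) = ↦e-IsAnswer (eRoot⇒↦e st) h
→e-IsAnswer (esubL st) (ans-esub w h) = ans-esub w (→e-IsAnswer st h)
→e-IsAnswer (esubR st) (ans-esub w h) = ans-esub _ h

-- An answer keeps the m-normal form of the body of its abstraction, so that the
-- normal form of an application is computed by structural recursion.

data MNf (n : ℕ) : Set
data Ans (n : ℕ) : Set

data MNf n where
  nonAns : Tm n → MNf n
  ans    : Ans n → MNf n

data Ans n where
  lamA  : Tm (suc n) → MNf (suc n) → Ans n
  esubA : Ans (suc n) → Tm n → Ans n

⌊_⌋ᴬ : Ans n → Tm n
⌊ lamA r _  ⌋ᴬ = lam r
⌊ esubA x w ⌋ᴬ = esub ⌊ x ⌋ᴬ w

⌊_⌋ : MNf n → Tm n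
⌊ nonAns a ⌋ = a
⌊ ans x ⌋    = ⌊ x ⌋ᴬ

esubNf : MNf (suc n) → Tm n → MNf n
esubNf (nonAns a) w = nonAns (esub a w)
esubNf (ans x)    w = ans (esubA x w)

appAns : Ans n → Tm n → MNf n
appAns (lamA r rr) u = esubNf rr u
appAns (esubA x w) u = esubNf (appAns x (wk u)) w

appNf : MNf n → Tm n → MNf n
appNf (nonAns a) u = nonAns (app a u)
appNf (ans x)    u = appAns x u

mnf : Tm n → MNf n
mnf (var x)    = nonAns (var x)
mnf (lam r)    = ans (lamA r (mnf r))
mnf (app t u)  = appNf (mnf t) ⌊ mnf u ⌋
mnf (esub t u) = esubNf (mnf t) ⌊ mnf u ⌋

⌊esubNf⌋ : (x : MNf (suc n)) (w : Tm n) → ⌊ esubNf x w ⌋ ≡ esub ⌊ x ⌋ w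
⌊esubNf⌋ (nonAns a) w = refl
⌊esubNf⌋ (ans x)    w = refl

IsAnswer-⌊⌋ᴬ : (x : Ans n) → IsAnswer ⌊ x ⌋ᴬ
IsAnswer-⌊⌋ᴬ (lamA r _)  = ans-lam r
IsAnswer-⌊⌋ᴬ (esubA x w) = ans-esub w (IsAnswer-⌊⌋ᴬ x)

mnf-IsAnswer : {t : Tm n} → IsAnswer t → ∃ λ y → mnf t ≡ ans y
mnf-IsAnswer (ans-lam r) = _ , refl
mnf-IsAnswer (ans-esub {t} w h) with mnf t | mnf-IsAnswer h
... | .(ans y) | y , refl = esubA y _ , refl

renNf  : (Fin n → Fin m) → MNf n → MNf m
renAns : (Fin n → Fin m) → Ans n → Ans m
renNf ρ (nonAns a)   = nonAns (ren ρ a)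
renNf ρ (ans x)      = ans (renAns ρ x)
renAns ρ (lamA r rr) = lamA (ren (liftRen ρ) r) (renNf (liftRen ρ) rr)
renAns ρ (esubA x w) = esubA (renAns (liftRen ρ) x) (ren ρ w)

⌊renAns⌋ : (ρ : Fin n → Fin m) (x : Ans n) → ⌊ renAns ρ x ⌋ᴬ ≡ ren ρ ⌊ x ⌋ᴬ
⌊renAns⌋ ρ (lamA r rr) = refl
⌊renAns⌋ ρ (esubA x w) = cong (λ z → esub z (ren ρ w)) (⌊renAns⌋ (liftRen ρ) x)

⌊renNf⌋ : (ρ : Fin n → Fin m) (x : MNf n) → ⌊ renNf ρ x ⌋ ≡ ren ρ ⌊ x ⌋
⌊renNf⌋ ρ (nonAns a) = refl
⌊renNf⌋ ρ (ans x)    = ⌊renAns⌋ ρ x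

esubNf-ren : (ρ : Fin n → Fin m) (x : MNf (suc n)) (w : Tm n) →
             esubNf (renNf (liftRen ρ) x) (ren ρ w) ≡ renNf ρ (esubNf x w)
esubNf-ren ρ (nonAns a) w = refl
esubNf-ren ρ (ans x)    w = refl

appAns-ren : (ρ : Fin n → Fin m) (x : Ans n) (u : Tm n) → appAns (renAns ρ x) (ren ρ u) ≡ renNf ρ (appAns x u)
appAns-ren ρ (lamA r rr) u = esubNf-ren ρ rr u
appAns-ren ρ (esubA x w) u = begin
  esubNf (appAns (renAns (liftRen ρ) x) (wk (ren ρ u))) (ren ρ w)
    ≡⟨ cong (λ z → esubNf (appAns (renAns (liftRen ρ) x) z) (ren ρ w)) (sym (ren-wk ρ u)) ⟩
  esubNf (appAns (renAns (liftRen ρ) x) (ren (liftRen ρ) (wk u))) (ren ρ w)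
    ≡⟨ cong (λ z → esubNf z (ren ρ w)) (appAns-ren (liftRen ρ) x (wk u)) ⟩
  esubNf (renNf (liftRen ρ) (appAns x (wk u))) (ren ρ w)
    ≡⟨ esubNf-ren ρ _ w ⟩
  renNf ρ (esubNf (appAns x (wk u)) w) ∎
  where open ≡-Reasoning

appNf-ren : (ρ : Fin n → Fin m) (x : MNf n) (u : Tm n) → appNf (renNf ρ x) (ren ρ u) ≡ renNf ρ (appNf x u)
appNf-ren ρ (nonAns a) u = refl
appNf-ren ρ (ans x)    u = appAns-ren ρ x u

mnf-ren : (ρ : Fin n → Fin m) (t : Tm n) → mnf (ren ρ t) ≡ renNf ρ (mnf t)
⌊mnf-ren⌋ : (ρ : Fin n → Fin m) (t : Tm n) → ⌊ mnf (ren ρ t) ⌋ ≡ ren ρ ⌊ mnf t ⌋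

mnf-ren ρ (var x)    = refl
mnf-ren ρ (lam t)    = cong (λ z → ans (lamA (ren (liftRen ρ) t) z)) (mnf-ren (liftRen ρ) t)
mnf-ren ρ (app t u)  =
  trans (cong₂ appNf (mnf-ren ρ t) (⌊mnf-ren⌋ ρ u)) (appNf-ren ρ (mnf t) ⌊ mnf u ⌋)
mnf-ren ρ (esub t u) =
  trans (cong₂ esubNf (mnf-ren (liftRen ρ) t) (⌊mnf-ren⌋ ρ u)) (esubNf-ren ρ (mnf t) ⌊ mnf u ⌋)

⌊mnf-ren⌋ ρ t = trans (cong ⌊_⌋ (mnf-ren ρ t)) (⌊renNf⌋ ρ (mnf t))

mnf-app-esub : {t : Tm (suc n)} → IsAnswer t → ∀ w u →
               mnf (app (esub t w) u) ≡ esubNf (mnf (app t (wk u))) ⌊ mnf w ⌋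
mnf-app-esub h w u with mnf-IsAnswer h
... | y , eq rewrite eq = cong (λ z → esubNf (appAns y z) ⌊ mnf w ⌋) (sym (⌊mnf-ren⌋ suc u))

↦m-mnf : {a b : Tm n} → a ↦m b → mnf a ≡ mnf b
↦m-mnf (dB r u)         = refl
↦m-mnf (dB-esub w u h) =
  trans (mnf-app-esub (↦m-IsAnswer h) w u) (cong (λ z → esubNf z ⌊ mnf w ⌋) (↦m-mnf h))

→m-mnf : {a b : Tm n} → a →m b → mnf a ≡ mnf b
→m-mnf (root h)          = ↦m-mnf (mRoot⇒↦m h)
→m-mnf (appR {t = t} h)  = cong (λ z → appNf (mnf t) ⌊ z ⌋) (→m-mnf h)
→m-mnf (appL {u = u} h)  = cong (λ z → appNf z ⌊ mnf u ⌋) (→m-mnf h)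
→m-mnf (esubL {u = u} h) = cong (λ z → esubNf z ⌊ mnf u ⌋) (→m-mnf h)
→m-mnf (esubR {t = t} h) = cong (λ z → esubNf (mnf t) ⌊ z ⌋) (→m-mnf h)

→m*-mnf : {a b : Tm n} → a →m* b → mnf a ≡ mnf b
→m*-mnf ε        = refl
→m*-mnf (h ◅ hs) = trans (→m-mnf h) (→m*-mnf hs)

data WfNf  {n : ℕ} : MNf n → Set
data WfAns {n : ℕ} : Ans n → Set

data WfNf where
  wf-nonAns : ∀ a → WfNf (nonAns a)
  wf-ans    : ∀ {x} → WfAns x → WfNf (ans x)

data WfAns where
  wf-lamA  : ∀ {r rr} → r →m* ⌊ rr ⌋ → WfNf rr → WfAns (lamA r rr)
  wf-esubA : ∀ {x} w → WfAns x → WfAns (esubA x w)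

esubNf-wf : {x : MNf (suc n)} → WfNf x → ∀ w → WfNf (esubNf x w)
esubNf-wf (wf-nonAns a) w = wf-nonAns _
esubNf-wf (wf-ans g)    w = wf-ans (wf-esubA w g)

appAns-wf : {x : Ans n} → WfAns x → ∀ u → WfNf (appAns x u)
appAns-wf (wf-lamA _ g)  u = esubNf-wf g u
appAns-wf (wf-esubA w g) u = esubNf-wf (appAns-wf g (wk u)) w

appAns-↦m : {x : Ans n} → WfAns x → ∀ u → ∃ λ c → app ⌊ x ⌋ᴬ u ↦m c × c →m* ⌊ appAns x u ⌋
appAns-↦m (wf-lamA {r} {rr} red _) u =
  esub r u , dB r u , subst (esub r u →m*_) (sym (⌊esubNf⌋ rr u)) (esubL* u red)
appAns-↦m {x = esubA x w} (wf-esubA w g) u with appAns-↦m g (wk u)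
... | c , step , red =
  esub c w , dB-esub w u step , subst (esub c w →m*_) (sym (⌊esubNf⌋ (appAns x (wk u)) w)) (esubL* w red)

appAns-→m* : {x : Ans n} → WfAns x → ∀ u → app ⌊ x ⌋ᴬ u →m* ⌊ appAns x u ⌋
appAns-→m* g u with appAns-↦m g u
... | _ , step , red = ↦m⇒→m step ◅ red

mnf-sound : (t : Tm n) → t →m* ⌊ mnf t ⌋ × WfNf (mnf t)
mnf-sound (var x) = ε , wf-nonAns _
mnf-sound (lam t) = ε , wf-ans (wf-lamA (proj₁ (mnf-sound t)) (proj₂ (mnf-sound t)))
mnf-sound (app t u) with mnf t | mnf-sound t | mnf-sound u
... | nonAns a | redt , _        | redu , _ = appL* u redt ◅◅ appR* a redu , wf-nonAns _
... | ans x    | redt , wf-ans g | redu , _ =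
  appL* u redt ◅◅ appR* ⌊ x ⌋ᴬ redu ◅◅ appAns-→m* g _ , appAns-wf g _
mnf-sound (esub t u) with mnf t | mnf-sound t | mnf-sound u
... | x | redt , g | redu , _ =
  subst (esub t u →m*_) (sym (⌊esubNf⌋ x ⌊ mnf u ⌋)) (esubL* u redt ◅◅ esubR* ⌊ x ⌋ redu) , esubNf-wf g _

→m*-⌊mnf⌋ : (t : Tm n) → t →m* ⌊ mnf t ⌋
→m*-⌊mnf⌋ t = proj₁ (mnf-sound t)

mnf-wf : (t : Tm n) → WfNf (mnf t)
mnf-wf t = proj₂ (mnf-sound t)

mnf-idem : (t : Tm n) → mnf ⌊ mnf t ⌋ ≡ mnf t
mnf-idem t = sym (→m*-mnf (→m*-⌊mnf⌋ t))

mNormal-→m* : {a b : Tm n} → mNormal a → a →m* b → a ≡ b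
mNormal-→m* normal ε          = refl
mNormal-→m* normal (step ◅ _) = ⊥-elim (normal (_ , step))

-- ⌊ mnf t ⌋ is never shown to be m-normal: t' is, and it reduces to ⌊ mnf t' ⌋.
IsMnf⇒≡⌊mnf⌋ : {t t' : Tm n} → IsMnf t t' → t' ≡ ⌊ mnf t ⌋
IsMnf⇒≡⌊mnf⌋ {t' = t'} (red , normal) =
  trans (mNormal-→m* normal (→m*-⌊mnf⌋ t')) (cong ⌊_⌋ (sym (→m*-mnf red)))

ren-≡s : (ρ : Fin n → Fin m) {a b : Tm n} → a ≡s b → ren ρ a ≡s ren ρ b
ren-≡s ρ ≡refl         = ≡refl
ren-≡s ρ (≡sym h)      = ≡sym (ren-≡s ρ h)
ren-≡s ρ (≡trans h h') = ≡trans (ren-≡s ρ h) (ren-≡s ρ h')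
ren-≡s ρ (≡com t s u)  =
  subst₂ _≡s_ (cong (λ z → esub (esub _ z) _) (sym (ren-wk ρ s)))
              (cong₂ (λ z z' → esub (esub z z') _) (ren-commute _ _ _ _ lift²-swap t) (sym (ren-wk ρ u)))
              (≡com (ren (liftRen (liftRen ρ)) t) (ren ρ s) (ren ρ u))
  where
  lift²-swap : swap01 ∘ liftRen (liftRen ρ) ≗ liftRen (liftRen ρ) ∘ swap01
  lift²-swap zero          = refl
  lift²-swap (suc zero)    = refl
  lift²-swap (suc (suc i)) = refl
ren-≡s ρ (≡appR t s u) =
  subst₂ _≡s_ refl (cong (λ z → esub (app z _) _) (sym (ren-wk ρ t)))
                   (≡appR (ren ρ t) (ren (liftRen ρ) s) (ren ρ u))
ren-≡s ρ (≡appL t u s) =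
  subst₂ _≡s_ refl (cong (λ z → esub (app _ z) _) (sym (ren-wk ρ s)))
                   (≡appL (ren (liftRen ρ) t) (ren ρ u) (ren ρ s))
ren-≡s ρ (≡assoc t u s) =
  subst₂ _≡s_ refl (cong (λ z → esub (esub z _) _) (sym (ren-liftRen-wk ρ t)))
                   (≡assoc (ren (liftRen ρ) t) (ren (liftRen ρ) u) (ren ρ s))
ren-≡s ρ (ctxAppR h)  = ctxAppR (ren-≡s ρ h)
ren-≡s ρ (ctxAppL h)  = ctxAppL (ren-≡s ρ h)
ren-≡s ρ (ctxEsubL h) = ctxEsubL (ren-≡s (liftRen ρ) h)
ren-≡s ρ (ctxEsubR h) = ctxEsubR (ren-≡s ρ h)

-- Structural equivalence of normal forms, tracking the shape of answers so that
-- it is preserved by appNf (a mere ⌊ x ⌋ ≡s ⌊ y ⌋ would not be).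

infix 4 _≈_ _≈ᴬ_

data _≈_  {n : ℕ} : MNf n → MNf n → Set
data _≈ᴬ_ {n : ℕ} : Ans n → Ans n → Set

data _≈_ where
  ≈-nonAns : ∀ {a b} → a ≡s b → nonAns a ≈ nonAns b
  ≈-ans    : ∀ {x y} → x ≈ᴬ y → ans x ≈ ans y

data _≈ᴬ_ where
  ≈-lamA  : ∀ r rr → lamA r rr ≈ᴬ lamA r rr
  ≈-esubA : ∀ {x y w w'} → x ≈ᴬ y → w ≡s w' → esubA x w ≈ᴬ esubA y w'
  ≈-assoc : ∀ {x y} u s → renAns (liftRen suc) x ≈ᴬ y → esubA x (esub u s) ≈ᴬ esubA (esubA y u) s

≈ᴬ-refl : (x : Ans n) → x ≈ᴬ x
≈ᴬ-refl (lamA r rr) = ≈-lamA r rr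
≈ᴬ-refl (esubA x w) = ≈-esubA (≈ᴬ-refl x) ≡refl

≈-refl : (x : MNf n) → x ≈ x
≈-refl (nonAns a) = ≈-nonAns ≡refl
≈-refl (ans x)    = ≈-ans (≈ᴬ-refl x)

≈ᴬ⇒≡s : {x y : Ans n} → x ≈ᴬ y → ⌊ x ⌋ᴬ ≡s ⌊ y ⌋ᴬ
≈ᴬ⇒≡s (≈-lamA r rr)         = ≡refl
≈ᴬ⇒≡s (≈-esubA h h')        = ≡trans (ctxEsubL (≈ᴬ⇒≡s h)) (ctxEsubR h')
≈ᴬ⇒≡s (≈-assoc {x} u s h) =
  ≡trans (≡assoc ⌊ x ⌋ᴬ u s) (ctxEsubL (ctxEsubL (subst (_≡s _) (⌊renAns⌋ (liftRen suc) x) (≈ᴬ⇒≡s h))))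

≈⇒≡s : {x y : MNf n} → x ≈ y → ⌊ x ⌋ ≡s ⌊ y ⌋
≈⇒≡s (≈-nonAns h) = h
≈⇒≡s (≈-ans h)    = ≈ᴬ⇒≡s h

esubNf-≈ : {x y : MNf (suc n)} {w w' : Tm n} → x ≈ y → w ≡s w' → esubNf x w ≈ esubNf y w'
esubNf-≈ (≈-nonAns h) h' = ≈-nonAns (≡trans (ctxEsubL h) (ctxEsubR h'))
esubNf-≈ (≈-ans h)    h' = ≈-ans (≈-esubA h h')

esubNf-assoc : (x : MNf (suc n)) (y : MNf (suc (suc n))) (u : Tm (suc n)) (s : Tm n) →
               renNf (liftRen suc) x ≈ y → esubNf x (esub u s) ≈ esubNf (esubNf y u) s
esubNf-assoc (nonAns a) (nonAns b) u s (≈-nonAns h) = ≈-nonAns (≡trans (≡assoc a u s) (ctxEsubL (ctxEsubL h)))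
esubNf-assoc (ans x)    (ans y)    u s (≈-ans h)    = ≈-ans (≈-assoc u s h)

appAns-≈ᴬ : {x y : Ans n} → x ≈ᴬ y → ∀ c → appAns x c ≈ appAns y c
appAns-≈ᴬ (≈-lamA r rr)  c = ≈-refl _
appAns-≈ᴬ (≈-esubA h h') c = esubNf-≈ (appAns-≈ᴬ h (wk c)) h'
appAns-≈ᴬ (≈-assoc {x} {y} u s h) c =
  esubNf-assoc (appAns x (wk c)) (appAns y (wk (wk c))) u s
    (subst (_≈ appAns y (wk (wk c))) renamed (appAns-≈ᴬ h (wk (wk c))))
  where
  renamed : appAns (renAns (liftRen suc) x) (wk (wk c)) ≡ renNf (liftRen suc) (appAns x (wk c))
  renamed = trans (cong (appAns (renAns (liftRen suc) x)) (sym (ren-wk suc c)))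
                  (appAns-ren (liftRen suc) x (wk c))

appNf-≈ : {x y : MNf n} → x ≈ y → ∀ c → appNf x c ≈ appNf y c
appNf-≈ (≈-nonAns h) c = ≈-nonAns (ctxAppL h)
appNf-≈ (≈-ans h)    c = appAns-≈ᴬ h c

appAns-≡s : (x : Ans n) {a b : Tm n} → a ≡s b → appAns x a ≈ appAns x b
appAns-≡s (lamA r rr) h = esubNf-≈ (≈-refl rr) h
appAns-≡s (esubA x w) h = esubNf-≈ (appAns-≡s x (ren-≡s suc h)) ≡refl

appNf-≡s : (x : MNf n) {a b : Tm n} → a ≡s b → appNf x a ≈ appNf x b
appNf-≡s (nonAns t) h = ≈-nonAns (ctxAppR h)
appNf-≡s (ans x)    h = appAns-≡s x h

⌜ren⌝ : (ρ : Fin n → Fin m) (t : Λ n) → ⌜ renΛ ρ t ⌝ ≡ ren ρ ⌜ t ⌝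
⌜ren⌝ ρ (var x)   = refl
⌜ren⌝ ρ (lam t)   = cong lam (⌜ren⌝ (liftRen ρ) t)
⌜ren⌝ ρ (app t u) = cong₂ app (⌜ren⌝ ρ t) (⌜ren⌝ ρ u)

⌊mnf⌜wk⌝⌋ : (t : Λ n) → ⌊ mnf ⌜ wkΛ t ⌝ ⌋ ≡ wk ⌊ mnf ⌜ t ⌝ ⌋
⌊mnf⌜wk⌝⌋ t = trans (cong (⌊_⌋ ∘ mnf) (⌜ren⌝ suc t)) (⌊mnf-ren⌋ suc ⌜ t ⌝)

σ-mnf : {t u : Λ n} → t →σ u → mnf ⌜ t ⌝ ≈ mnf ⌜ u ⌝
σ-mnf (σ₁ t u s) rewrite ⌊mnf⌜wk⌝⌋ s with mnf ⌜ t ⌝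
... | nonAns a = ≈-nonAns (≡appL a ⌊ mnf ⌜ u ⌝ ⌋ ⌊ mnf ⌜ s ⌝ ⌋)
... | ans x    = ≈-refl _
σ-mnf (σ₃ _ (var x) s u) rewrite ⌊esubNf⌋ (mnf ⌜ s ⌝) ⌊ mnf ⌜ u ⌝ ⌋ =
  ≈-nonAns (≡appR (var x) ⌊ mnf ⌜ s ⌝ ⌋ ⌊ mnf ⌜ u ⌝ ⌋)
σ-mnf (σ₃ _ (lam w) s u) rewrite ⌊esubNf⌋ (mnf ⌜ s ⌝) ⌊ mnf ⌜ u ⌝ ⌋
                               | ⌜ren⌝ (liftRen suc) w | mnf-ren (liftRen suc) ⌜ w ⌝ with mnf ⌜ w ⌝
... | nonAns a = ≈-nonAns (≡assoc a _ _)
... | ans x    = ≈-ans (≈-assoc _ _ (≈ᴬ-refl _))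
σ-mnf (appR {t = t} h) = appNf-≡s (mnf ⌜ t ⌝) (≈⇒≡s (σ-mnf h))
σ-mnf (appL h)         = appNf-≈ (σ-mnf h) _
σ-mnf (redex h)        = esubNf-≈ (σ-mnf h) ≡refl

⌊mnf-esub⌋ : (t : Tm (suc n)) (u : Tm n) → ⌊ mnf (esub t u) ⌋ ≡ esub ⌊ mnf t ⌋ ⌊ mnf u ⌋
⌊mnf-esub⌋ t u = ⌊esubNf⌋ (mnf t) ⌊ mnf u ⌋

mnf-esub-app : {z : Tm (suc n)} → IsAnswer z → ∀ a w c →
               mnf a ≡ mnf (app z (wk c)) → mnf (esub a w) ≡ mnf (app (esub z w) c)
mnf-esub-app h a w c eq = trans (cong (λ q → esubNf q ⌊ mnf w ⌋) eq) (sym (mnf-app-esub h w c))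

infix 4 _→e/m_

_→e/m_ : Tm n → Tm n → Set
a →e/m b = ∃ λ z → a →e z × mnf z ≡ mnf b

↦e-app : {t : Tm (suc n)} {w z : Tm n} → IsAnswer t → esub t w ↦e z →
         ∀ c {p} → app t (wk c) →m* p → ∃ λ q → esub p w ↦e q × mnf q ≡ mnf (app z c)
↦e-app {t = t} _ (sv _ {v} val) c {p} red =
  p ⟦0≔ v ⟧ , sv p val ,
  sym (trans (cong (λ q → mnf (app (t ⟦0≔ v ⟧) q)) (sym (wk-⟦0≔⟧ c v))) (→m*-mnf (→m*-sub _ red)))
↦e-app {t = t} h (sv-esub w st) c {p} red
  with ↦e-app (IsAnswer-ren _ h) st (wk c) {ren (liftRen suc) p}
              (subst (λ q → app (ren (liftRen suc) t) q →m* ren (liftRen suc) p) (ren-wk suc c)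
                     (→m*-ren (liftRen suc) red))
... | q , st' , eq = esub q w , sv-esub w st' , mnf-esub-app (↦e-IsAnswer st (IsAnswer-ren _ h)) q w c eq

appAns-→e-fun : {x : Ans n} → WfAns x → ∀ {z} → ⌊ x ⌋ᴬ →e z → ∀ c → ⌊ appAns x c ⌋ →e/m app z c
appAns-→e-fun (wf-lamA _ _) (root ()) c
appAns-→e-fun {x = esubA x w} (wf-esubA w g) (root st) c
  with ↦e-app (IsAnswer-⌊⌋ᴬ x) (eRoot⇒↦e st) c (appAns-→m* g (wk c))
... | q , st' , eq = q , subst (_→e q) (sym (⌊esubNf⌋ (appAns x (wk c)) w)) (↦e⇒→e st') , eq
appAns-→e-fun {x = esubA x w} (wf-esubA w g) (esubL st) c with appAns-→e-fun g st (wk c)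
... | q , st' , eq = esub q w , subst (_→e esub q w) (sym (⌊esubNf⌋ (appAns x (wk c)) w)) (esubL st') ,
                     mnf-esub-app (→e-IsAnswer st (IsAnswer-⌊⌋ᴬ x)) q w c eq
appAns-→e-fun {x = esubA x w} (wf-esubA w g) (esubR {u' = w'} st) c =
  esub ⌊ appAns x (wk c) ⌋ w' , subst (_→e _) (sym (⌊esubNf⌋ (appAns x (wk c)) w)) (esubR st) ,
  mnf-esub-app (IsAnswer-⌊⌋ᴬ x) ⌊ appAns x (wk c) ⌋ w' c (sym (→m*-mnf (appAns-→m* g (wk c))))

appAns-→e-arg : {x : Ans n} → WfAns x → ∀ {c c'} → c →e c' → ⌊ appAns x c ⌋ →e/m app ⌊ x ⌋ᴬ c'
appAns-→e-arg (wf-lamA {rr = rr} red _) {c} {c'} st =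
  esub ⌊ rr ⌋ c' , subst (_→e _) (sym (⌊esubNf⌋ rr c)) (esubR st) ,
  cong (λ q → esubNf q ⌊ mnf c' ⌋) (sym (→m*-mnf red))
appAns-→e-arg {x = esubA x w} (wf-esubA w g) {c} {c'} st with appAns-→e-arg g (→e-ren suc st)
... | q , st' , eq = esub q w , subst (_→e _) (sym (⌊esubNf⌋ (appAns x (wk c)) w)) (esubL st') ,
                     mnf-esub-app (IsAnswer-⌊⌋ᴬ x) q w c' eq

appNf-→e-fun : {x : MNf n} → WfNf x → ∀ {z} → ⌊ x ⌋ →e z → ∀ c → ⌊ appNf x c ⌋ →e/m app z c
appNf-→e-fun (wf-nonAns a) {z} st c = app z c , appL st , refl
appNf-→e-fun (wf-ans g)        st c = appAns-→e-fun g st c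

appNf-→e-arg : {x : MNf n} → WfNf x → ∀ {c c'} → c →e c' → ⌊ appNf x c ⌋ →e/m app ⌊ x ⌋ c'
appNf-→e-arg (wf-nonAns a) {c' = c'} st = app a c' , appR st , refl
appNf-→e-arg (wf-ans g)                st = appAns-→e-arg g st

Value-⌊mnf⌋ : {v : Tm n} → Value v → ⌊ mnf v ⌋ ≡ v
Value-⌊mnf⌋ (var x) = refl
Value-⌊mnf⌋ (lam t) = refl

mnf-sub-⌊mnf⌋ : (σ : Fin n → Tm m) (t : Tm n) → mnf (sub σ ⌊ mnf t ⌋) ≡ mnf (sub σ t)
mnf-sub-⌊mnf⌋ σ t = sym (→m*-mnf (→m*-sub σ (→m*-⌊mnf⌋ t)))

↦e-mnf : {a b : Tm n} → a ↦e b → ∃ λ z → ⌊ mnf a ⌋ ↦e z × mnf z ≡ mnf b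
↦e-mnf (sv t {v} val) =
  ⌊ mnf t ⌋ ⟦0≔ v ⟧ ,
  subst (_↦e ⌊ mnf t ⌋ ⟦0≔ v ⟧) (sym (trans (⌊mnf-esub⌋ t v) (cong (esub ⌊ mnf t ⌋) (Value-⌊mnf⌋ val))))
        (sv _ val) ,
  mnf-sub-⌊mnf⌋ _ t
↦e-mnf (sv-esub {t} {V} w st) with ↦e-mnf st
... | z , st' , eq =
  esub z ⌊ mnf w ⌋ ,
  subst (_↦e esub z ⌊ mnf w ⌋)
        (sym (trans (⌊mnf-esub⌋ t (esub V w)) (cong (esub ⌊ mnf t ⌋) (⌊mnf-esub⌋ V w))))
        (sv-esub ⌊ mnf w ⌋ (subst (_↦e z)
                                  (trans (⌊mnf-esub⌋ (ren (liftRen suc) t) V)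
                                         (cong (λ q → esub q ⌊ mnf V ⌋) (⌊mnf-ren⌋ (liftRen suc) t)))
                                  st')) ,
  cong₂ esubNf eq (cong ⌊_⌋ (mnf-idem w))

→e-mnf : {a b : Tm n} → a →e b → ⌊ mnf a ⌋ →e/m b
→e-mnf (root st) with ↦e-mnf (eRoot⇒↦e st)
... | z , st' , eq = z , ↦e⇒→e st' , eq
→e-mnf (appL {t} {u = c} st) with →e-mnf st
... | z , st' , eq with appNf-→e-fun (mnf-wf t) st' ⌊ mnf c ⌋
... | q , st'' , eq' = q , st'' , trans eq' (cong₂ appNf eq (cong ⌊_⌋ (mnf-idem c)))
→e-mnf (appR {t = a} st) with →e-mnf st
... | z , st' , eq with appNf-→e-arg (mnf-wf a) st'
... | q , st'' , eq' = q , st'' , trans eq' (cong₂ appNf (mnf-idem a) (cong ⌊_⌋ eq))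
→e-mnf (esubL {t} {u = c} st) with →e-mnf st
... | z , st' , eq = esub z ⌊ mnf c ⌋ , subst (_→e _) (sym (⌊mnf-esub⌋ t c)) (esubL st') ,
                     cong₂ esubNf eq (cong ⌊_⌋ (mnf-idem c))
→e-mnf (esubR {t = a} {u} st) with →e-mnf st
... | z , st' , eq = esub ⌊ mnf a ⌋ z , subst (_→e _) (sym (⌊mnf-esub⌋ a u)) (esubR st') ,
                     cong₂ esubNf (mnf-idem a) (cong ⌊_⌋ eq)

⌜sub⌝ : (σ : Fin n → Λ m) (t : Λ n) → ⌜ subΛ σ t ⌝ ≡ sub (⌜_⌝ ∘ σ) ⌜ t ⌝
⌜sub⌝ σ (var x)   = refl
⌜sub⌝ σ (lam t)   = cong lam (trans (⌜sub⌝ (liftSubΛ σ) t) (sub-cong ⌜liftSub⌝ ⌜ t ⌝))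
  where
  ⌜liftSub⌝ : ⌜_⌝ ∘ liftSubΛ σ ≗ liftSub (⌜_⌝ ∘ σ)
  ⌜liftSub⌝ zero    = refl
  ⌜liftSub⌝ (suc i) = ⌜ren⌝ suc (σ i)
⌜sub⌝ σ (app t u) = cong₂ app (⌜sub⌝ σ t) (⌜sub⌝ σ u)

⌜⟦0≔⟧⌝ : (t : Λ (suc n)) (v : Λ n) → ⌜ t ⟦0≔ v ⟧Λ ⌝ ≡ ⌜ t ⌝ ⟦0≔ ⌜ v ⌝ ⟧
⌜⟦0≔⟧⌝ t v = trans (⌜sub⌝ _ t) (sub-cong (λ { zero → refl ; (suc i) → refl }) ⌜ t ⌝)

⌜Value⌝ : {v : Λ n} → ΛValue v → Value ⌜ v ⌝
⌜Value⌝ (var x) = var x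
⌜Value⌝ (lam t) = lam _

⌜β⌝ : (t : Λ (suc n)) (u : Λ n) → ⌜ app (lam t) u ⌝ →m esub ⌜ t ⌝ ⌜ u ⌝
⌜β⌝ t u = ↦m⇒→m (dB _ _)

βv-simulation : {t u : Λ n} → t →βv u → ∃₂ λ x y → ⌜ t ⌝ →m* x × x →e y × ⌜ u ⌝ →m* y
βv-simulation (βv t v val) =
  esub ⌜ t ⌝ ⌜ v ⌝ , ⌜ t ⌝ ⟦0≔ ⌜ v ⌝ ⟧ , ⌜β⌝ t v ◅ ε , ↦e⇒→e (sv _ (⌜Value⌝ val)) ,
  subst (⌜ t ⟦0≔ v ⟧Λ ⌝ →m*_) (⌜⟦0≔⟧⌝ t v) ε
βv-simulation (appR {t} st) with βv-simulation st
... | x , y , r₁ , e , r₂ = app ⌜ t ⌝ x , app ⌜ t ⌝ y , appR* _ r₁ , appR e , appR* _ r₂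
βv-simulation (appL {u = u} st) with βv-simulation st
... | x , y , r₁ , e , r₂ = app x ⌜ u ⌝ , app y ⌜ u ⌝ , appL* _ r₁ , appL e , appL* _ r₂
βv-simulation (redex {t} {t'} {u} st) with βv-simulation st
... | x , y , r₁ , e , r₂ =
  esub x ⌜ u ⌝ , esub y ⌜ u ⌝ , ⌜β⌝ t u ◅ esubL* _ r₁ , esubL e , ⌜β⌝ t' u ◅ esubL* _ r₂

σ-⌊mnf⌋ : {t u : Λ n} → t →σ u → ⌊ mnf ⌜ t ⌝ ⌋ ≡s ⌊ mnf ⌜ u ⌝ ⌋
σ-⌊mnf⌋ st = ≈⇒≡s (σ-mnf st)

βv-⌊mnf⌋ : {t u : Λ n} → t →βv u → ∃ λ s → ⌊ mnf ⌜ t ⌝ ⌋ →e s × s →m* ⌊ mnf ⌜ u ⌝ ⌋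
βv-⌊mnf⌋ st with βv-simulation st
... | x , y , r₁ , e , r₂ with →e-mnf e
... | z , e' , eq =
  z , subst (_→e z) (cong ⌊_⌋ (sym (→m*-mnf r₁))) e' ,
  subst (z →m*_) (cong ⌊_⌋ (trans eq (sym (→m*-mnf r₂)))) (→m*-⌊mnf⌋ z)

lemma6 : ∀ {n : ℕ} (t u : Λ n) →
    (t →σ u → ∀ t' u' → IsMnf ⌜ t ⌝ t' → IsMnf ⌜ u ⌝ u' → t' ≡s u')
    × (t →βv u → ∀ t' u' → IsMnf ⌜ t ⌝ t' → IsMnf ⌜ u ⌝ u' →
        ∃ (λ s → t' →e s × s →m* u'))
lemma6 t u = σ-case , βv-case
  where
  σ-case : t →σ u → ∀ t' u' → IsMnf ⌜ t ⌝ t' → IsMnf ⌜ u ⌝ u' → t' ≡s u'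
  σ-case st t' u' mt mu rewrite IsMnf⇒≡⌊mnf⌋ mt | IsMnf⇒≡⌊mnf⌋ mu = σ-⌊mnf⌋ st

  βv-case : t →βv u → ∀ t' u' → IsMnf ⌜ t ⌝ t' → IsMnf ⌜ u ⌝ u' → ∃ (λ s → t' →e s × s →m* u')
  βv-case st t' u' mt mu rewrite IsMnf⇒≡⌊mnf⌋ mt | IsMnf⇒≡⌊mnf⌋ mu = βv-⌊mnf⌋ st
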